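{- Let $L = (a_0, a_1, a_2)$ be a \textsc{Rotisserie Nim} position with three heaps. If $a_0 = 1$ and $a_1 > a_2$, then $L \in \mathcal{P}$.
   Context: \textsc{Rotisserie Nim} is an impartial combinatorial game played under normal play (a player unable to move loses). A position is a finite list $L = (a_0, a_1, \ldots, a_n)$ of positive integers (a queue of heaps, $a_0$ at the front); the empty list is terminal. The options of $L$ are $(a_1, \ldots, a_n)$ and $(a_1, \ldots, a_n, b)$ for every integer $b$ with $1 \leq b < a_0$. $\mathcal{N}$ denotes the positions from which the next player to move wins, $\mathcal{P}$ those from which the previous player wins. -}

module Defs where

open import Data.Nat using (ℕ; _<_; _≤_)
open import Data.List using (List; []; _∷_; _++_; [_])
open import Data.Product using (Σ; _×_)

data Move : List ℕ → List ℕ → Set where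
  remove : ∀ a as → Move (a ∷ as) as
  rotate : ∀ a as b → 1 ≤ b → b < a → Move (a ∷ as) (as ++ [ b ])

-- Outcome classes under normal play, defined inductively
-- (the game is short, so every position lies in exactly one of them).
data 𝒫 : List ℕ → Set
data 𝒩 : List ℕ → Set

data 𝒫 where
  allN : ∀ {L} → (∀ L' → Move L L' → 𝒩 L') → 𝒫 L

data 𝒩 where
  someP : ∀ {L} L' → Move L L' → 𝒫 L' → 𝒩 L

-- With two heaps (b, c) and b ≤ c, any rotation leaves (c, d) with d < b ≤ c, and the
-- reply that rotates c down to d restores an equal pair (d, d); strong induction on
-- the front heap shows (b, c) ∈ 𝒫. A front heap of 1 can only be removed, so
-- (1, a, b) with a > b moves only to (a, b), which reaches the 𝒫-position (b, b).
module Submission where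

open import Defs
open import Data.Nat using (ℕ; _<_; _>_; _≤_; s≤s; z≤n)
open import Data.Nat.Properties using (≤-refl; <-≤-trans)
open import Data.Nat.Induction using (<-wellFounded)
open import Data.List using (List; []; _∷_)
open import Induction.WellFounded using (Acc; acc)
open import Relation.Binary.PropositionalEquality using (_≡_; refl)

𝒫-[] : 𝒫 []
𝒫-[] = allN λ _ ()

𝒩-singleton : ∀ c → 𝒩 (c ∷ [])
𝒩-singleton c = someP [] (remove c []) 𝒫-[]

𝒫-one∷ : ∀ {as} → 𝒩 as → 𝒫 (1 ∷ as)
𝒫-one∷ as∈𝒩 = allN λ
  { _ (remove _ _)                       → as∈𝒩
  ; _ (rotate _ _ _ (s≤s z≤n) (s≤s ())) }

𝒫-pair-acc : ∀ {b c} → Acc _<_ b → b ≤ c → 𝒫 (b ∷ c ∷ [])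
𝒩-pair-acc : ∀ {c d} → Acc _<_ d → 0 < d → d < c → 𝒩 (c ∷ d ∷ [])

𝒫-pair-acc {c = c} (acc rs) b≤c = allN λ
  { _ (remove _ _)            → 𝒩-singleton c
  ; _ (rotate _ _ d 1≤d d<b) → 𝒩-pair-acc (rs d<b) 1≤d (<-≤-trans d<b b≤c) }

𝒩-pair-acc {c} {d} d-acc 0<d d<c =
  someP (d ∷ d ∷ []) (rotate c (d ∷ []) d 0<d d<c) (𝒫-pair-acc d-acc ≤-refl)

𝒩-pair : ∀ {c d} → 0 < d → d < c → 𝒩 (c ∷ d ∷ [])
𝒩-pair = 𝒩-pair-acc (<-wellFounded _)

mainTheorem6 : (a₀ a₁ a₂ : ℕ) → 0 < a₀ → 0 < a₁ → 0 < a₂ →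
    a₀ ≡ 1 → a₁ > a₂ → 𝒫 (a₀ ∷ a₁ ∷ a₂ ∷ [])
mainTheorem6 .1 a₁ a₂ _ _ 0<a₂ refl a₁>a₂ = 𝒫-one∷ (𝒩-pair 0<a₂ a₁>a₂)
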